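{- Let $k\geq2$, let $n<r<\frac{(k-1)(2n)}{k}$, and let $\mathcal{F}\subseteq\mathcal{H}^r(M_n)$ be $k$-wise intersecting. Let $\sigma$ be a good cyclic ordering that is saturated and such that every set in $\mathcal{F}_\sigma$ contains $\sigma(2n)$. Let $\mu$ be the good cyclic ordering obtained from $\sigma$ by exchanging the entries in positions $n-1$ and $2n-1$. If $\mu$ is saturated, then every set in $\mathcal{F}_\mu$ contains $\mu(2n)$ $(=\sigma(2n))$.
   Context: $M_n$ is the perfect matching on vertex set $[2n]=\{1,\dots,2n\}$ with edges $\{i,n+i\}$, $1\le i\le n$; the two endpoints of an edge are partners. $\mathcal{H}^r(M_n)$ is the family of $r$-subsets of $[2n]$ that are either independent in $M_n$ or contain a maximum independent set of $M_n$. A family is $k$-wise intersecting if any $k$ members have a common element. A good cyclic ordering is a bijection $\sigma:[2n]\to[2n]$ (where $\sigma(p)$ is the vertex at position $p$, positions taken mod $2n$) such that for each $p\in[n]$, $\sigma(p)$ and $\sigma(p+n)$ are partners. A $\sigma$-interval of length $r$ is a set $\{\sigma(p),\sigma(p+1),\dots,\sigma(p+r-1)\}$ (positions mod $2n$). $\mathcal{F}_\sigma$ is the set of members of $\mathcal{F}$ that are $\sigma$-intervals, and $\sigma$ is saturated if $|\mathcal{F}_\sigma|=r$. -}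

module Defs where

open import Data.Nat using (ℕ; zero; suc; _+_; _*_; _∸_; _≤_; _<_; _<?_; s≤s)
open import Data.Fin using (Fin; toℕ; fromℕ<) renaming (zero to fzero)
open import Data.Fin.Subset using (Subset; _∈_; _⊆_; ∣_∣; ⁅_⁆; _∪_; ⊥)
open import Data.Bool using (Bool; true; false)
open import Data.List using (List; length; filterᵇ; allFin; upTo; foldr; map)
open import Data.Product using (_×_; ∃)
open import Data.Sum using (_⊎_)
open import Relation.Binary.PropositionalEquality using (_≡_; _≢_)
open import Relation.Nullary using (¬_; yes; no)
open import Function.Definitions using (Bijective)

-- Conventions (0-based): vertex v : Fin (2n) stands for vertex toℕ v + 1 of [2n];
-- position index i : Fin (2n) stands for position i taken mod 2n (so σ(2n) = σ at index 0).

Partners : (n : ℕ) → Fin (2 * n) → Fin (2 * n) → Set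
Partners n u v = (toℕ u + n ≡ toℕ v) ⊎ (toℕ v + n ≡ toℕ u)

Independent : (n : ℕ) → Subset (2 * n) → Set
Independent n S = ∀ u v → u ∈ S → v ∈ S → ¬ Partners n u v

MaxIndependent : (n : ℕ) → Subset (2 * n) → Set
MaxIndependent n I = Independent n I × (∀ J → Independent n J → ∣ J ∣ ≤ ∣ I ∣)

InH : (n r : ℕ) → Subset (2 * n) → Set
InH n r S = (∣ S ∣ ≡ r) × (Independent n S ⊎ ∃ λ I → I ⊆ S × MaxIndependent n I)

Family : ℕ → Set
Family n = Subset (2 * n) → Bool

InF : (n : ℕ) → Subset (2 * n) → Family n → Set
InF n S F = F S ≡ true

SubfamilyH : (n r : ℕ) → Family n → Set
SubfamilyH n r F = ∀ S → InF n S F → InH n r S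

-- any k members (not necessarily distinct) have a common element
KWiseIntersecting : (n k : ℕ) → Family n → Set
KWiseIntersecting n k F =
  (G : Fin k → Subset (2 * n)) → (∀ i → InF n (G i) F) → ∃ λ x → ∀ i → x ∈ G i

Ordering : ℕ → Set
Ordering n = Fin (2 * n) → Fin (2 * n)

GoodCyclic : (n : ℕ) → Ordering n → Set
GoodCyclic n σ = Bijective _≡_ _≡_ σ ×
  (∀ (i j : Fin (2 * n)) → toℕ j ≡ toℕ i + n → Partners n (σ i) (σ j))

cyc : ∀ {m} → Fin m → Fin m
cyc {suc m} i with suc (toℕ i) <? suc m
... | yes p = fromℕ< p
... | no _ = fzero

iter : ∀ {m} → ℕ → Fin m → Fin m
iter zero p = p
iter (suc j) p = cyc (iter j p)

interval : (n : ℕ) → Ordering n → ℕ → Fin (2 * n) → Subset (2 * n)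
interval n σ r p = foldr (λ j S → ⁅ σ (iter j p) ⁆ ∪ S) ⊥ (upTo r)

-- |F_σ|: number of starting positions p whose length-r σ-interval lies in F
-- (for 0 < r < 2n distinct starting positions give distinct intervals)
countFσ : (n : ℕ) → Family n → Ordering n → ℕ → ℕ
countFσ n F σ r = length (filterᵇ (λ p → F (interval n σ r p)) (allFin (2 * n)))

Saturated : (n : ℕ) → Family n → Ordering n → ℕ → Set
Saturated n F σ r = countFσ n F σ r ≡ r

AllContainLast : (n : ℕ) → Family n → Ordering n → ℕ → Set
AllContainLast n F σ r = ∀ (p z : Fin (2 * n)) → InF n (interval n σ r p) F →
  toℕ z ≡ 0 → σ z ∈ interval n σ r p

SwapOf : (n : ℕ) → Ordering n → Ordering n → Set
SwapOf n σ μ =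
  (∀ (a b : Fin (2 * n)) → toℕ a ≡ n ∸ 1 → toℕ b ≡ 2 * n ∸ 1 → (μ a ≡ σ b) × (μ b ≡ σ a)) ×
  (∀ (i : Fin (2 * n)) → toℕ i ≢ n ∸ 1 → toℕ i ≢ 2 * n ∸ 1 → μ i ≡ σ i)

-- Positions are numbered from 0, so σ(2n) sits at position 0 and μ exchanges the positions
-- A = n - 1 and B = 2n - 1. Let m = 2n - r; then 1 ≤ m < n and r < (k - 1) m.
-- Since σ is saturated and all its intervals in F contain position 0, F contains every
-- σ-interval through 0; equivalently, for 1 ≤ b ≤ r the σ-interval missing exactly the window
-- [b, b + m) is in F. A μ-interval in F missing position 0 would start at some s ∈ [1, m].
-- At s = m it equals a σ-interval, which is excluded. At s = c < m it misses [0, c), A and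
-- [c + r, B), and k - 2 windows would cover the rest, contradicting k-wise intersection, unless
-- c < ρ = r - (k - 2) m. The same covering argument forbids μ-intervals in F at c and at
-- w ∈ [n, n + m) with w ≡ c + ρ (mod m). Pairing [1, m) with [n, n + m) in this way (the residue
-- class of ρ goes to a suitable absent c*) yields fewer than r μ-intervals in F, contradicting
-- the saturation of μ.

module Submission where

open import Defs
open import Data.Nat using (ℕ; _*_; _∸_; _≤_; _<_)
open import Data.Nat using (zero; suc; _+_; _⊓_; _<?_; _≤?_; _≟_; NonZero; >-nonZero; z≤n; s≤s)
open import Data.Nat.Properties
open import Data.Nat.Tactic.RingSolver using (solve-∀)
open import Data.Nat.DivMod using (_%_; _/_; _mod_; m%n<n; m<n⇒m%n≡m; n%n≡0; m%n%n≡m%n; %-distribˡ-+; [m+n]%n≡m%n; m≤n⇒[n∸m]%m≡n%m; m/n*n≤m; m<n*o⇒m/o<n; m≡m%n+[m/n]*n)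
open import Data.Fin using (Fin; toℕ; fromℕ<; cast) renaming (zero to fzero; suc to fsuc)
open import Data.Fin.Properties using (toℕ<n; toℕ-fromℕ<; toℕ-injective; fromℕ<-injective; injective⇒≤; cast-involutive) renaming (_≟_ to _≟ᶠ_)
open import Data.Fin.Subset using (Subset; _∈_; _∉_; ⁅_⁆; _∪_; _⊆_) renaming (⊥ to ∅)
open import Data.Fin.Subset.Properties using (⊆-antisym; x∈⁅y⁆⇒x≡y; x∈⁅x⁆; x∈p∪q⁻; x∈p∪q⁺; ∉⊥)
open import Data.Bool using (Bool; true; false)
import Data.Bool as Bool
open import Data.Bool.Properties using (T-≡; ¬-not)
open import Data.List using (List; []; _∷_; length; lookup; filterᵇ; allFin; foldr; upTo; map; _++_)
open import Data.List.Properties using (length-map; length-upTo; length-++)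
open import Data.List.Membership.Propositional using (lose) renaming (_∈_ to _∈ₗ_)
open import Data.List.Membership.Propositional.Properties using (∈-lookup; ∈-filter⁻; ∈-upTo⁺; ∈-upTo⁻; ∈-map⁺)
open import Data.List.Relation.Unary.All as All using (All; _∷_)
import Data.List.Relation.Unary.All.Properties as All
open import Data.List.Relation.Unary.Any as Any using (Any; here; there)
open import Data.List.Relation.Unary.Any.Properties using (lookup-index; ++⁺ˡ; ++⁺ʳ)
open import Data.List.Relation.Unary.Unique.Propositional using (Unique)
open import Data.List.Relation.Unary.Unique.Propositional.Properties using (allFin⁺; filter⁺)
open import Data.List.Relation.Unary.AllPairs using (_∷_)
open import Data.Product using (∃-syntax; _×_; _,_; proj₁; proj₂)
open import Data.Sum using (_⊎_; inj₁; inj₂)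
open import Data.Empty using (⊥; ⊥-elim)
open import Data.Fin.Permutation.Components using (transpose)
open import Function using (_∘_; Injective; Equivalence)
open import Relation.Nullary using (¬_; yes; no; contradiction)
open import Relation.Binary.Definitions using (tri<; tri≈; tri>)
open import Relation.Unary using (Decidable)
open import Relation.Nullary.Decidable using (T?; _×-dec_)
open import Relation.Binary.PropositionalEquality

module _ {A : Set} where

  lookup-injective : ∀ {xs : List A} → Unique xs → ∀ {i j} → lookup xs i ≡ lookup xs j → i ≡ j
  lookup-injective (_ ∷ _) {fzero} {fzero} _ = refl
  lookup-injective (x∉xs ∷ _) {fzero} {fsuc j} x≡ = contradiction x≡ (All.lookup x∉xs (∈-lookup j))
  lookup-injective (x∉xs ∷ _) {fsuc i} {fzero} ≡x = contradiction (sym ≡x) (All.lookup x∉xs (∈-lookup i))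
  lookup-injective (_ ∷ u) {fsuc i} {fsuc j} eq = cong fsuc (lookup-injective u eq)

  length≤-injection : ∀ {xs : List A} {B} (h : A → ℕ) → Unique xs →
    (∀ {x} → x ∈ₗ xs → h x < B) →
    (∀ {x y} → x ∈ₗ xs → y ∈ₗ xs → h x ≡ h y → x ≡ y) → length xs ≤ B
  length≤-injection {xs} h unique h< h-injective = injective⇒≤ f-injective
    where
    f : Fin (length xs) → Fin _
    f i = fromℕ< (h< (∈-lookup i))
    f-injective : Injective _≡_ _≡_ f
    f-injective {i} {j} fi≡fj = lookup-injective unique (h-injective (∈-lookup i) (∈-lookup j)
      (fromℕ<-injective _ _ (h< (∈-lookup i)) (h< (∈-lookup j)) fi≡fj))

length-filter< : ∀ {N B} (P : Fin N → Bool) (h : Fin N → ℕ) (i₀ : Fin N) → P i₀ ≡ false →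
  (∀ i → P i ≡ true ⊎ i ≡ i₀ → h i < B) →
  (∀ i j → P i ≡ true ⊎ i ≡ i₀ → P j ≡ true ⊎ j ≡ i₀ → h i ≡ h j → i ≡ j) →
  length (filterᵇ P (allFin N)) < B
length-filter< {N} P h i₀ ¬Pi₀ h< h-injective = length≤-injection h (All.tabulate i₀∉ ∷ unique)
  (h< _ ∘ classify) (λ i∈ j∈ → h-injective _ _ (classify i∈) (classify j∈))
  where
  holds : ∀ {i} → i ∈ₗ filterᵇ P (allFin N) → P i ≡ true
  holds i∈ = Equivalence.to T-≡ (proj₂ (∈-filter⁻ (T? ∘ P) {xs = allFin N} i∈))
  unique : Unique (filterᵇ P (allFin N))
  unique = filter⁺ (T? ∘ P) {allFin N} (allFin⁺ N)
  i₀∉ : ∀ {i} → i ∈ₗ filterᵇ P (allFin N) → i₀ ≢ i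
  i₀∉ i∈ refl with () ← trans (sym ¬Pi₀) (holds i∈)
  classify : ∀ {i} → i ∈ₗ i₀ ∷ filterᵇ P (allFin N) → P i ≡ true ⊎ i ≡ i₀
  classify (here refl) = inj₂ refl
  classify (there i∈) = inj₁ (holds i∈)

toℕ-cyc : ∀ {N} (i : Fin (suc N)) → toℕ (cyc i) ≡ suc (toℕ i) % suc N
toℕ-cyc {N} i with suc (toℕ i) <? suc N
... | yes i+1<N = trans (toℕ-fromℕ< i+1<N) (sym (m<n⇒m%n≡m i+1<N))
... | no i+1≮N = sym (trans (cong (_% suc N) (≤-antisym (toℕ<n i) (≮⇒≥ i+1≮N))) (n%n≡0 (suc N)))

toℕ-iter : ∀ {N} j (p : Fin (suc N)) → toℕ (iter j p) ≡ (toℕ p + j) % suc N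
toℕ-iter zero p = sym (trans (cong (_% _) (+-identityʳ (toℕ p))) (m<n⇒m%n≡m (toℕ<n p)))
toℕ-iter {N} (suc j) p = begin
  toℕ (cyc (iter j p))                   ≡⟨ toℕ-cyc (iter j p) ⟩
  (1 + toℕ (iter j p)) % suc N           ≡⟨ cong (λ x → (1 + x) % suc N) (toℕ-iter j p) ⟩
  (1 + (toℕ p + j) % suc N) % suc N      ≡⟨ %-distribˡ-+ 1 _ (suc N) ⟩
  (1 % suc N + (toℕ p + j) % suc N % suc N) % suc N
    ≡⟨ cong (λ x → (1 % suc N + x) % suc N) (m%n%n≡m%n (toℕ p + j) (suc N)) ⟩
  (1 % suc N + (toℕ p + j) % suc N) % suc N ≡⟨ %-distribˡ-+ 1 (toℕ p + j) (suc N) ⟨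
  (1 + (toℕ p + j)) % suc N              ≡⟨ cong (_% suc N) (+-suc (toℕ p) j) ⟨
  (toℕ p + suc j) % suc N                ∎
  where open ≡-Reasoning

-- y lies on the cyclic interval s, s + 1, …, s + r - 1 of positions mod N (for s, y < N)
OnArc : ℕ → ℕ → ℕ → ℕ → Set
OnArc N r s y = (s ≤ y × y < s + r) ⊎ (y < s × y + N < s + r)

module _ {N r : ℕ} (r≤N : r ≤ suc N) where

  iter-OnArc : ∀ (p : Fin (suc N)) {j} → j < r → OnArc (suc N) r (toℕ p) (toℕ (iter j p))
  iter-OnArc p {j} j<r with toℕ p + j <? suc N
  ... | yes p+j<N = inj₁ (subst (toℕ p ≤_) (sym iter≡p+j) (m≤m+n (toℕ p) j) ,
                          subst (_< toℕ p + r) (sym iter≡p+j) (+-monoʳ-< (toℕ p) j<r))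
    where
    iter≡p+j : toℕ (iter j p) ≡ toℕ p + j
    iter≡p+j = trans (toℕ-iter j p) (m<n⇒m%n≡m p+j<N)
  ... | no p+j≮N = inj₂ (+-cancelʳ-< _ _ _ (subst (_< toℕ p + suc N) (sym iter+N≡p+j) p+j<p+N) ,
                         subst (_< toℕ p + r) (sym iter+N≡p+j) (+-monoʳ-< (toℕ p) j<r))
    where
    N≤p+j = ≮⇒≥ p+j≮N
    p+j<p+N = +-monoʳ-< (toℕ p) (<-≤-trans j<r r≤N)
    p+j∸N<N : toℕ p + j ∸ suc N < suc N
    p+j∸N<N = subst (toℕ p + j ∸ suc N <_) (m+n∸n≡m (suc N) (suc N))
      (∸-monoˡ-< (+-mono-< (toℕ<n p) (<-≤-trans j<r r≤N)) N≤p+j)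
    iter+N≡p+j : toℕ (iter j p) + suc N ≡ toℕ p + j
    iter+N≡p+j = begin
      toℕ (iter j p) + suc N                  ≡⟨ cong (_+ suc N) (toℕ-iter j p) ⟩
      (toℕ p + j) % suc N + suc N             ≡⟨ cong (_+ suc N) (m≤n⇒[n∸m]%m≡n%m N≤p+j) ⟨
      (toℕ p + j ∸ suc N) % suc N + suc N     ≡⟨ cong (_+ suc N) (m<n⇒m%n≡m p+j∸N<N) ⟩
      toℕ p + j ∸ suc N + suc N               ≡⟨ m∸n+n≡m N≤p+j ⟩
      toℕ p + j                               ∎
      where open ≡-Reasoning

  OnArc-iter : ∀ (p y : Fin (suc N)) → OnArc (suc N) r (toℕ p) (toℕ y) → ∃[ j ] j < r × iter j p ≡ y
  OnArc-iter p y (inj₁ (p≤y , y<p+r)) =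
    toℕ y ∸ toℕ p , +-cancelˡ-< (toℕ p) _ _ (subst (_< toℕ p + r) (sym p+j≡y) y<p+r) ,
    toℕ-injective (trans (toℕ-iter _ p) (trans (cong (_% suc N) p+j≡y) (m<n⇒m%n≡m (toℕ<n y))))
    where
    p+j≡y : toℕ p + (toℕ y ∸ toℕ p) ≡ toℕ y
    p+j≡y = m+[n∸m]≡n p≤y
  OnArc-iter p y (inj₂ (y<p , y+N<p+r)) =
    toℕ y + suc N ∸ toℕ p , +-cancelˡ-< (toℕ p) _ _ (subst (_< toℕ p + r) (sym p+j≡y+N) y+N<p+r) ,
    toℕ-injective (trans (toℕ-iter _ p) (trans (cong (_% suc N) p+j≡y+N)
      (trans ([m+n]%n≡m%n (toℕ y) (suc N)) (m<n⇒m%n≡m (toℕ<n y)))))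
    where
    p+j≡y+N : toℕ p + (toℕ y + suc N ∸ toℕ p) ≡ toℕ y + suc N
    p+j≡y+N = m+[n∸m]≡n (≤-trans (<⇒≤ (toℕ<n p)) (m≤n+m (suc N) (toℕ y)))

module _ {K} (g : ℕ → Fin K) where

  private
    ⋃⁅_⁆ : List ℕ → Subset K
    ⋃⁅ l ⁆ = foldr (λ j S → ⁅ g j ⁆ ∪ S) ∅ l

  ∈-⋃⁅⁆⁻ : ∀ l {x} → x ∈ ⋃⁅ l ⁆ → ∃[ j ] j ∈ₗ l × x ≡ g j
  ∈-⋃⁅⁆⁻ [] x∈ = ⊥-elim (∉⊥ x∈)
  ∈-⋃⁅⁆⁻ (j ∷ l) x∈ with x∈p∪q⁻ _ _ x∈
  ... | inj₁ x∈⁅gj⁆ = j , here refl , x∈⁅y⁆⇒x≡y _ x∈⁅gj⁆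
  ... | inj₂ x∈⋃ with ∈-⋃⁅⁆⁻ l x∈⋃
  ...   | i , i∈l , x≡gi = i , there i∈l , x≡gi

  ∈-⋃⁅⁆⁺ : ∀ l {j} → j ∈ₗ l → g j ∈ ⋃⁅ l ⁆
  ∈-⋃⁅⁆⁺ (j ∷ l) (here refl) = x∈p∪q⁺ (inj₁ (x∈⁅x⁆ _))
  ∈-⋃⁅⁆⁺ (_ ∷ l) (there j∈l) = x∈p∪q⁺ (inj₂ (∈-⋃⁅⁆⁺ l j∈l))

module _ {n'} (τ : Ordering (suc n')) {r} (r≤N : r ≤ 2 * suc n') where

  OnArc⇒∈-interval : ∀ {p y} → OnArc (2 * suc n') r (toℕ p) (toℕ y) → τ y ∈ interval (suc n') τ r p
  OnArc⇒∈-interval {p} {y} onArc with OnArc-iter r≤N p y onArc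
  ... | j , j<r , refl = ∈-⋃⁅⁆⁺ (λ j → τ (iter j p)) (upTo r) (∈-upTo⁺ j<r)

  ∈-interval⇒OnArc : Injective _≡_ _≡_ τ →
    ∀ {p y} → τ y ∈ interval (suc n') τ r p → OnArc (2 * suc n') r (toℕ p) (toℕ y)
  ∈-interval⇒OnArc τ-injective {p} {y} τy∈ with ∈-⋃⁅⁆⁻ (λ j → τ (iter j p)) (upTo r) τy∈
  ... | j , j∈ , τy≡ =
    subst (OnArc _ r (toℕ p) ∘ toℕ) (τ-injective (sym τy≡)) (iter-OnArc r≤N p (∈-upTo⁻ j∈))

-- the offset of position 0 in an interval starting at the given position
distanceTo0 : ∀ {N} → Fin N → ℕ
distanceTo0 fzero = 0
distanceTo0 {N} i@(fsuc _) = N ∸ toℕ i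

distanceTo0-injective : ∀ {N} → Injective _≡_ _≡_ (distanceTo0 {N})
distanceTo0-injective {_} {fzero} {fzero} _ = refl
distanceTo0-injective {_} {fzero} {j@(fsuc _)} 0≡ = contradiction 0≡ (<⇒≢ (m<n⇒0<n∸m (toℕ<n j)))
distanceTo0-injective {_} {i@(fsuc _)} {fzero} ≡0 = contradiction (sym ≡0) (<⇒≢ (m<n⇒0<n∸m (toℕ<n i)))
distanceTo0-injective {_} {i@(fsuc _)} {j@(fsuc _)} eq =
  toℕ-injective (∸-cancelˡ-≡ (<⇒≤ (toℕ<n i)) (<⇒≤ (toℕ<n j)) eq)

OnArc-0⇒distanceTo0< : ∀ {N r} (t : Fin N) → OnArc N r (toℕ t) 0 → distanceTo0 t < r
OnArc-0⇒distanceTo0< fzero (inj₁ (_ , 0<r)) = 0<r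
OnArc-0⇒distanceTo0< {N} {r} t@(fsuc _) (inj₂ (_ , N<t+r)) =
  +-cancelˡ-< (toℕ t) _ _ (subst (_< toℕ t + r) (sym (m+[n∸m]≡n (<⇒≤ (toℕ<n t)))) N<t+r)

module _ {n'} (F : Family (suc n')) (τ : Ordering (suc n')) (τ-injective : Injective _≡_ _≡_ τ)
         {r} (r≤N : r ≤ 2 * suc n') where

  -- The starts of intervals through 0 are told apart by their distance to 0, which is below r;
  -- so r intervals in F through 0 leave no room for one outside F.
  saturated⇒complete : Saturated (suc n') F τ r → AllContainLast (suc n') F τ r →
    ∀ t → OnArc (2 * suc n') r (toℕ t) 0 → F (interval (suc n') τ r t) ≡ true
  saturated⇒complete saturated allContain t t↝0 with F (interval (suc n') τ r t) in ¬Ft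
  ... | true = refl
  ... | false = ⊥-elim (<-irrefl saturated
    (length-filter< (λ p → F (interval (suc n') τ r p)) distanceTo0 t ¬Ft
      (λ i i↝0 → OnArc-0⇒distanceTo0< i (toOrigin i i↝0)) (λ _ _ _ _ → distanceTo0-injective)))
    where
    toOrigin : ∀ i → F (interval (suc n') τ r i) ≡ true ⊎ i ≡ t → OnArc (2 * suc n') r (toℕ i) 0
    toOrigin i (inj₁ Fi) = ∈-interval⇒OnArc τ r≤N τ-injective (allContain i fzero Fi refl)
    toOrigin i (inj₂ refl) = t↝0

module _ {N} (a b : Fin N) where

  transpose-cases : ∀ y → (y ≡ a × transpose a b y ≡ b) ⊎ (y ≡ b × transpose a b y ≡ a) ⊎
                          (y ≢ a × y ≢ b × transpose a b y ≡ y)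
  transpose-cases y with y ≟ᶠ a
  ... | yes y≡a = inj₁ (y≡a , refl)
  ... | no y≢a with y ≟ᶠ b
  ...   | yes y≡b = inj₂ (inj₁ (y≡b , refl))
  ...   | no y≢b = inj₂ (inj₂ (y≢a , y≢b , refl))

module _ {n} {σ μ : Ordering n} {a b : Fin (2 * n)}
         (a≡ : toℕ a ≡ n ∸ 1) (b≡ : toℕ b ≡ 2 * n ∸ 1) where

  SwapOf⇒σ≡μ∘transpose : SwapOf n σ μ → ∀ y → σ y ≡ μ (transpose a b y)
  SwapOf⇒σ≡μ∘transpose (swapped , fixed) y with transpose-cases a b y
  ... | inj₁ (refl , ty≡b) = trans (sym (proj₂ (swapped y b a≡ b≡))) (cong μ (sym ty≡b))
  ... | inj₂ (inj₁ (refl , ty≡a)) = trans (sym (proj₁ (swapped a y a≡ b≡))) (cong μ (sym ty≡a))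
  ... | inj₂ (inj₂ (y≢a , y≢b , ty≡y)) =
    trans (sym (fixed y (y≢a ∘ ≡-toℕ a≡) (y≢b ∘ ≡-toℕ b≡))) (cong μ (sym ty≡y))
    where
    ≡-toℕ : ∀ {c k} → toℕ c ≡ k → toℕ y ≡ k → y ≡ c
    ≡-toℕ c≡ y≡ = toℕ-injective (trans y≡ (sym c≡))

bounded⇒exit : (P : ℕ → Set) → Decidable P → ∀ {b d} → 0 < d → (∀ {v} → P v → v < b) →
  ∀ {c} → P c → ∃[ v ] P v × ¬ P (v + d)
bounded⇒exit P P? {b} {d} 0<d bounded {c} Pc = exit b (m≤n+m b c) Pc
  where
  exit : ∀ fuel {v} → b ≤ v + fuel → P v → ∃[ v ] P v × ¬ P (v + d)
  exit zero {v} b≤v Pv = ⊥-elim (<⇒≱ (bounded Pv) (subst (b ≤_) (+-identityʳ v) b≤v))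
  exit (suc fuel) {v} b≤ Pv with P? (v + d)
  ... | no ¬Pv+d = v , Pv , ¬Pv+d
  ... | yes Pv+d =
    exit fuel (≤-trans b≤ (≤-trans (≤-reflexive (+-suc v fuel)) (+-monoˡ-≤ fuel v+1≤v+d))) Pv+d
    where
    v+1≤v+d : suc v ≤ v + d
    v+1≤v+d = subst (_≤ v + d) (+-comm v 1) (+-monoʳ-≤ v 0<d)

module _ {m} .{{_ : NonZero m}} where

  private
    %≡∧/<⇒+≤ : ∀ {x y} → x % m ≡ y % m → x / m < y / m → x + m ≤ y
    %≡∧/<⇒+≤ {x} {y} x%≡y% x/<y/ = begin
      x + m                     ≡⟨ cong (_+ m) (m≡m%n+[m/n]*n x m) ⟩
      x % m + x / m * m + m     ≡⟨ +-assoc (x % m) _ m ⟩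
      x % m + (x / m * m + m)   ≡⟨ cong₂ _+_ x%≡y% (+-comm _ m) ⟩
      y % m + suc (x / m) * m   ≤⟨ +-monoʳ-≤ (y % m) (*-monoˡ-≤ m x/<y/) ⟩
      y % m + y / m * m         ≡⟨ m≡m%n+[m/n]*n y m ⟨
      y                         ∎
      where open ≤-Reasoning

  %-injective-close : ∀ {x y} → x < y + m → y < x + m → x % m ≡ y % m → x ≡ y
  %-injective-close {x} {y} x<y+m y<x+m x%≡y% with <-cmp (x / m) (y / m)
  ... | tri< x/<y/ _ _ = ⊥-elim (<⇒≱ y<x+m (%≡∧/<⇒+≤ x%≡y% x/<y/))
  ... | tri> _ _ y/<x/ = ⊥-elim (<⇒≱ x<y+m (%≡∧/<⇒+≤ (sym x%≡y%) y/<x/))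
  ... | tri≈ _ x/≡y/ _ = begin
      x                   ≡⟨ m≡m%n+[m/n]*n x m ⟩
      x % m + x / m * m   ≡⟨ cong₂ (λ u v → u + v * m) x%≡y% x/≡y/ ⟩
      y % m + y / m * m   ≡⟨ m≡m%n+[m/n]*n y m ⟨
      y                   ∎
      where open ≡-Reasoning

module SwapArgument
  (n' k₂ r : ℕ) (n<r : suc n' < r) (rk<[k-1]N : r * suc (suc k₂) < suc k₂ * (2 * suc n'))
  (F : Family (suc n')) (kwise : KWiseIntersecting (suc n') (suc (suc k₂)) F)
  (σ : Ordering (suc n')) (σ-good : GoodCyclic (suc n') σ)
  (σ-saturated : Saturated (suc n') F σ r) (σ-allContain : AllContainLast (suc n') F σ r)
  (μ : Ordering (suc n')) (swapped : SwapOf (suc n') σ μ) (μ-good : GoodCyclic (suc n') μ)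
  (μ-saturated : Saturated (suc n') F μ r)
  where

  n N m : ℕ
  n = suc n'
  N = 2 * n
  m = N ∸ r

  N≡n+n : N ≡ n + n
  N≡n+n = cong (n +_) (+-identityʳ n)

  r<N : r < N
  r<N = ≰⇒> λ N≤r → <⇒≱ rk<[k-1]N (begin
    suc k₂ * N          ≤⟨ *-monoʳ-≤ (suc k₂) N≤r ⟩
    suc k₂ * r          ≤⟨ *-monoˡ-≤ r (n≤1+n (suc k₂)) ⟩
    suc (suc k₂) * r    ≡⟨ *-comm (suc (suc k₂)) r ⟩
    r * suc (suc k₂)    ∎)
    where open ≤-Reasoning

  r+m≡N : r + m ≡ N
  r+m≡N = m+[n∸m]≡n (<⇒≤ r<N)

  m+r≡N : m + r ≡ N
  m+r≡N = trans (+-comm m r) r+m≡N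

  +m+r≡+N : ∀ x → x + m + r ≡ x + N
  +m+r≡+N x = trans (+-assoc x m r) (cong (x +_) m+r≡N)

  m<n : m < n
  m<n = ≰⇒> λ n≤m → <-irrefl (trans (sym N≡n+n) (sym r+m≡N)) (+-mono-<-≤ n<r n≤m)

  0<r : 0 < r
  0<r = ≤-trans (s≤s z≤n) n<r

  0<m : 0 < m
  0<m = m<n⇒0<n∸m r<N

  instance
    m-nonZero : NonZero m
    m-nonZero = >-nonZero 0<m

  r<[k-1]m : r < suc k₂ * m
  r<[k-1]m = +-cancelʳ-< (suc k₂ * r) r (suc k₂ * m) (begin-strict
    r + suc k₂ * r          ≡⟨ cong (r +_) (*-comm (suc k₂) r) ⟩
    r + r * suc k₂          ≡⟨ *-suc r (suc k₂) ⟨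
    r * suc (suc k₂)        <⟨ rk<[k-1]N ⟩
    suc k₂ * N              ≡⟨ cong (suc k₂ *_) r+m≡N ⟨
    suc k₂ * (r + m)        ≡⟨ *-distribˡ-+ (suc k₂) r m ⟩
    suc k₂ * r + suc k₂ * m ≡⟨ +-comm (suc k₂ * r) (suc k₂ * m) ⟩
    suc k₂ * m + suc k₂ * r ∎)
    where open ≤-Reasoning

  σ-injective : Injective _≡_ _≡_ σ
  σ-injective = proj₁ (proj₁ σ-good)

  σ-surjective : ∀ x → ∃[ y ] σ y ≡ x
  σ-surjective x = proj₁ (proj₂ (proj₁ σ-good) x) , proj₂ (proj₂ (proj₁ σ-good) x) refl

  μ-injective : Injective _≡_ _≡_ μ
  μ-injective = proj₁ (proj₁ μ-good)

  toℕ-mod : ∀ {s} → s < N → toℕ (s mod N) ≡ s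
  toℕ-mod s<N = trans (toℕ-fromℕ< _) (m<n⇒m%n≡m s<N)

  mod-toℕ : ∀ (p : Fin N) → toℕ p mod N ≡ p
  mod-toℕ p = toℕ-injective (toℕ-mod (toℕ<n p))

  σarc μarc : ℕ → Subset N
  σarc s = interval n σ r (s mod N)
  μarc s = interval n μ r (s mod N)

  ∈σarc⇒OnArc : ∀ {s y} → σ y ∈ σarc s → OnArc N r (s % N) (toℕ y)
  ∈σarc⇒OnArc σy∈ =
    subst (λ t → OnArc N r t _) (toℕ-fromℕ< _) (∈-interval⇒OnArc σ (<⇒≤ r<N) σ-injective σy∈)

  OnArc⇒∈σarc : ∀ {s y} → OnArc N r (s % N) (toℕ y) → σ y ∈ σarc s
  OnArc⇒∈σarc onArc =
    OnArc⇒∈-interval σ (<⇒≤ r<N) (subst (λ t → OnArc N r t _) (sym (toℕ-fromℕ< _)) onArc)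

  A B : ℕ
  A = n'
  B = N ∸ 1

  A<B : A < B
  A<B = subst (A <_) (sym (+-suc n' (n' + 0))) (s≤s (m≤m+n n' (n' + 0)))

  a b : Fin N
  a = fromℕ< (m≤m+n n (n + 0))
  b = fromℕ< (n<1+n B)

  π : Fin N → Fin N
  π = transpose a b

  σ≡μ∘π : ∀ y → σ y ≡ μ (π y)
  σ≡μ∘π = SwapOf⇒σ≡μ∘transpose {n} (toℕ-fromℕ< _) (toℕ-fromℕ< _) swapped

  ∈μarc⇒OnArc : ∀ {s y} → s < N → σ y ∈ μarc s → OnArc N r s (toℕ (π y))
  ∈μarc⇒OnArc s<N σy∈ = subst (λ t → OnArc N r t _) (toℕ-mod s<N)
    (∈-interval⇒OnArc μ (<⇒≤ r<N) μ-injective (subst (_∈ _) (σ≡μ∘π _) σy∈))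

  OnArc⇒∈μarc : ∀ {s y} → s < N → OnArc N r s (toℕ (π y)) → σ y ∈ μarc s
  OnArc⇒∈μarc s<N onArc = subst (_∈ _) (sym (σ≡μ∘π _))
    (OnArc⇒∈-interval μ (<⇒≤ r<N) (subst (λ t → OnArc N r t _) (sym (toℕ-mod s<N)) onArc))

  π-fixes : ∀ {y} → toℕ y ≢ A → toℕ y ≢ B → π y ≡ y
  π-fixes {y} y≢A y≢B with transpose-cases a b y
  ... | inj₁ (refl , _) = ⊥-elim (y≢A (toℕ-fromℕ< _))
  ... | inj₂ (inj₁ (refl , _)) = ⊥-elim (y≢B (toℕ-fromℕ< _))
  ... | inj₂ (inj₂ (_ , _ , πy≡y)) = πy≡y

  toℕ-π-A : ∀ {y} → toℕ y ≡ A → toℕ (π y) ≡ B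
  toℕ-π-A {y} y≡A with transpose-cases a b y
  ... | inj₁ (_ , πy≡b) = trans (cong toℕ πy≡b) (toℕ-fromℕ< _)
  ... | inj₂ (inj₁ (refl , _)) = ⊥-elim (<-irrefl (trans (sym y≡A) (toℕ-fromℕ< _)) A<B)
  ... | inj₂ (inj₂ (y≢a , _ , _)) = ⊥-elim (y≢a (toℕ-injective (trans y≡A (sym (toℕ-fromℕ< _)))))

  toℕ-π-B : ∀ {y} → toℕ y ≡ B → toℕ (π y) ≡ A
  toℕ-π-B {y} y≡B with transpose-cases a b y
  ... | inj₁ (refl , _) = ⊥-elim (<-irrefl (trans (sym (toℕ-fromℕ< _)) y≡B) A<B)
  ... | inj₂ (inj₁ (_ , πy≡a)) = trans (cong toℕ πy≡a) (toℕ-fromℕ< _)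
  ... | inj₂ (inj₂ (_ , y≢b , _)) = ⊥-elim (y≢b (toℕ-injective (trans y≡B (sym (toℕ-fromℕ< _)))))

  σarc∈F : ∀ {s} → OnArc N r (s % N) 0 → F (σarc s) ≡ true
  σarc∈F {s} s↝0 = saturated⇒complete F σ σ-injective (<⇒≤ r<N) σ-saturated σ-allContain (s mod N)
    (subst (λ t → OnArc N r t 0) (sym (toℕ-fromℕ< _)) s↝0)

  -- the σ-interval whose complement is [b, b + m)
  window : ℕ → Subset N
  window b = σarc (b + m)

  private
    window-start : ∀ {b} → b ≤ r → (b < r × (b + m) % N ≡ b + m) ⊎ (b ≡ r × (b + m) % N ≡ 0)
    window-start {b} b≤r with m≤n⇒m<n∨m≡n b≤r
    ... | inj₁ b<r = inj₁ (b<r , m<n⇒m%n≡m (subst (b + m <_) r+m≡N (+-monoˡ-< m b<r)))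
    ... | inj₂ refl = inj₂ (refl , trans (cong (_% N) r+m≡N) (n%n≡0 N))

  window∈F : ∀ {b} → 1 ≤ b → b ≤ r → F (window b) ≡ true
  window∈F {b} 1≤b b≤r with window-start b≤r
  ... | inj₁ (b<r , start≡) = σarc∈F {b + m} (subst (λ t → OnArc N r t 0) (sym start≡)
    (inj₂ (≤-trans 1≤b (m≤m+n b m) , subst (N <_) (sym (+m+r≡+N b)) (+-monoˡ-≤ N 1≤b))))
  ... | inj₂ (refl , start≡) =
    σarc∈F {b + m} (subst (λ t → OnArc N r t 0) (sym start≡) (inj₁ (z≤n , ≤-trans 1≤b b≤r)))

  ∉window : ∀ {b y} → b ≤ r → b ≤ toℕ y → toℕ y < b + m → σ y ∉ window b
  ∉window {b} {y} b≤r b≤y y<b+m σy∈ with window-start b≤r | ∈σarc⇒OnArc {b + m} σy∈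
  ... | inj₁ (_ , start≡) | onArc with subst (λ t → OnArc N r t (toℕ y)) start≡ onArc
  ...   | inj₁ (b+m≤y , _) = <⇒≱ y<b+m b+m≤y
  ...   | inj₂ (_ , y+N<b+m+r) =
    <⇒≱ y+N<b+m+r (subst (_≤ toℕ y + N) (sym (+m+r≡+N b)) (+-monoˡ-≤ N b≤y))
  ∉window {b} {y} b≤r b≤y y<b+m σy∈ | inj₂ (refl , start≡) | onArc
    with subst (λ t → OnArc N r t (toℕ y)) start≡ onArc
  ...   | inj₁ (_ , y<r) = <⇒≱ y<r b≤y

  Member : Subset N → Set
  Member S = InF n S F

  windows : ℕ → ℕ → List (Subset N)
  windows c q = map (λ j → window ((c + j * m) ⊓ r)) (upTo q)

  length-windows : ∀ c q → length (windows c q) ≡ q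
  length-windows c q = trans (length-map _ (upTo q)) (length-upTo q)

  windows∈F : ∀ {c} → 1 ≤ c → ∀ q → All Member (windows c q)
  windows∈F {c} 1≤c q =
    All.map⁺ (All.universal (λ j → window∈F (⊓-glb (≤-trans 1≤c (m≤m+n c _)) 0<r) (m⊓n≤n _ r)) (upTo q))

  windows-miss : ∀ {c q y} → c ≤ toℕ y → toℕ y < c + q * m → Any (σ y ∉_) (windows c q)
  windows-miss {c} {q} {y} c≤y y<c+qm = lose (∈-map⁺ (λ j → window ((c + j * m) ⊓ r)) (∈-upTo⁺ j<q)) y∉
    where
    d = toℕ y ∸ c
    j = d / m
    c+d≡y : c + d ≡ toℕ y
    c+d≡y = m+[n∸m]≡n c≤y
    j<q : j < q
    j<q = m<n*o⇒m/o<n (+-cancelˡ-< c d (q * m) (subst (_< c + q * m) (sym c+d≡y) y<c+qm))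
    start≤y : c + j * m ≤ toℕ y
    start≤y = subst (c + j * m ≤_) c+d≡y (+-monoʳ-≤ c (m/n*n≤m d m))
    d<jm+m : d < j * m + m
    d<jm+m = begin-strict
      d             ≡⟨ m≡m%n+[m/n]*n d m ⟩
      d % m + j * m <⟨ +-monoˡ-< (j * m) (m%n<n d m) ⟩
      m + j * m     ≡⟨ +-comm m (j * m) ⟩
      j * m + m     ∎
      where open ≤-Reasoning
    y<start+m : toℕ y < c + j * m + m
    y<start+m = subst₂ _<_ c+d≡y (sym (+-assoc c (j * m) m)) (+-monoʳ-< c d<jm+m)
    y∉ : σ y ∉ window ((c + j * m) ⊓ r)
    y∉ with c + j * m ≤? r
    ... | yes start≤r =
      subst (λ b → σ y ∉ window b) (sym (m≤n⇒m⊓n≡m start≤r)) (∉window start≤r start≤y y<start+m)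
    ... | no start≰r =
      subst (λ b → σ y ∉ window b) (sym (m≥n⇒m⊓n≡n r≤start)) (∉window ≤-refl (≤-trans r≤start start≤y) y<r+m)
      where
      r≤start = <⇒≤ (≰⇒> start≰r)
      y<r+m = subst (toℕ y <_) (sym r+m≡N) (toℕ<n y)

  ¬cover : (Gs : List (Subset N)) → length Gs ≡ suc (suc k₂) → All Member Gs →
    ¬ (∀ y → Any (σ y ∉_) Gs)
  ¬cover Gs |Gs|≡k Gs∈F cover
    with kwise (λ i → lookup Gs (cast (sym |Gs|≡k) i)) (λ i → All.lookup Gs∈F (∈-lookup _))
  ... | x , x∈G with σ-surjective x
  ...   | y , refl = lookup-index (cover y)
    (subst (σ y ∈_) (cong (lookup Gs) (cast-involutive (sym |Gs|≡k) |Gs|≡k i)) (x∈G (cast |Gs|≡k i)))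
    where
    i = Any.index (cover y)

  Present : ℕ → Set
  Present s = Member (μarc s)

  private
    OnArc-π : ∀ {s} → OnArc N r s A → OnArc N r s B → ∀ y →
      (OnArc N r s (toℕ (π y)) → OnArc N r s (toℕ y)) × (OnArc N r s (toℕ y) → OnArc N r s (toℕ (π y)))
    OnArc-π {s} A↝ B↝ y with transpose-cases a b y
    ... | inj₁ (refl , πy≡b) = (λ _ → a↝) , (λ _ → subst (OnArc N r s ∘ toℕ) (sym πy≡b) b↝)
      where a↝ = subst (OnArc N r s) (sym (toℕ-fromℕ< _)) A↝
            b↝ = subst (OnArc N r s) (sym (toℕ-fromℕ< _)) B↝
    ... | inj₂ (inj₁ (refl , πy≡a)) = (λ _ → b↝) , (λ _ → subst (OnArc N r s ∘ toℕ) (sym πy≡a) a↝)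
      where a↝ = subst (OnArc N r s) (sym (toℕ-fromℕ< _)) A↝
            b↝ = subst (OnArc N r s) (sym (toℕ-fromℕ< _)) B↝
    ... | inj₂ (inj₂ (_ , _ , πy≡y)) =
      subst (OnArc N r s ∘ toℕ) πy≡y , subst (OnArc N r s ∘ toℕ) (sym πy≡y)

  μarc≡σarc : ∀ {s} → s < N → OnArc N r s A → OnArc N r s B → μarc s ≡ σarc s
  μarc≡σarc {s} s<N A↝ B↝ = ⊆-antisym μarc⊆σarc σarc⊆μarc
    where
    s%N≡s = m<n⇒m%n≡m s<N
    μarc⊆σarc : μarc s ⊆ σarc s
    μarc⊆σarc {x} x∈ with σ-surjective x
    ... | y , refl = OnArc⇒∈σarc {s} (subst (λ t → OnArc N r t _) (sym s%N≡s)
          (proj₁ (OnArc-π A↝ B↝ y) (∈μarc⇒OnArc s<N x∈)))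
    σarc⊆μarc : σarc s ⊆ μarc s
    σarc⊆μarc {x} x∈ with σ-surjective x
    ... | y , refl = OnArc⇒∈μarc s<N (proj₂ (OnArc-π A↝ B↝ y)
          (subst (λ t → OnArc N r t _) s%N≡s (∈σarc⇒OnArc {s} x∈)))

  m<N : m < N
  m<N = <-≤-trans m<n (m≤m+n n (n + 0))

  B<N : B < N
  B<N = n<1+n B

  ¬present-m : ¬ Present m
  ¬present-m present = ¬m↝0 (subst (λ t → OnArc N r t 0) (m<n⇒m%n≡m m<N)
    (∈σarc⇒OnArc {m} (σ-allContain (m mod N) fzero (subst Member (μarc≡σarc m<N A↝ B↝) present) refl)))
    where
    m≤A : m ≤ A
    m≤A = ≤-pred m<n
    A↝ : OnArc N r m A
    A↝ = inj₁ (m≤A , subst (A <_) (sym m+r≡N) (<-trans A<B B<N))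
    B↝ : OnArc N r m B
    B↝ = inj₁ (≤-trans m≤A (<⇒≤ A<B) , subst (B <_) (sym m+r≡N) B<N)
    ¬m↝0 : ¬ OnArc N r m 0
    ¬m↝0 (inj₁ (m≤0 , _)) = <⇒≱ 0<m m≤0
    ¬m↝0 (inj₂ (_ , N<m+r)) = <-irrefl (sym m+r≡N) N<m+r

  c+r<N : ∀ {c} → c < m → c + r < N
  c+r<N {c} c<m = subst (c + r <_) m+r≡N (+-monoˡ-< r c<m)

  ∉μarc-front : ∀ {c y} → c < m → toℕ y < c ⊎ toℕ y ≡ A ⊎ (c + r ≤ toℕ y × toℕ y ≢ B) → σ y ∉ μarc c
  ∉μarc-front {c} {y} c<m y-cases σy∈ = ¬onArc y-cases (∈μarc⇒OnArc (<-trans c<m m<N) σy∈)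
    where
    c<A : c < A
    c<A = <-≤-trans c<m (≤-pred m<n)
    A<c+r : A < c + r
    A<c+r = <-≤-trans (<-trans (n<1+n n') n<r) (m≤n+m r c)
    fixed : toℕ y ≢ A → toℕ y ≢ B → OnArc N r c (toℕ (π y)) → OnArc N r c (toℕ y)
    fixed y≢A y≢B = subst (OnArc N r c ∘ toℕ) (π-fixes y≢A y≢B)
    ¬onArc : toℕ y < c ⊎ toℕ y ≡ A ⊎ (c + r ≤ toℕ y × toℕ y ≢ B) → ¬ OnArc N r c (toℕ (π y))
    ¬onArc (inj₁ y<c) onArc with fixed (<⇒≢ (<-trans y<c c<A)) (<⇒≢ (<-trans (<-trans y<c c<A) A<B)) onArc
    ... | inj₁ (c≤y , _) = <⇒≱ y<c c≤y
    ... | inj₂ (_ , y+N<c+r) = <⇒≱ y+N<c+r (≤-trans (<⇒≤ (c+r<N c<m)) (m≤n+m N (toℕ y)))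
    ¬onArc (inj₂ (inj₁ y≡A)) onArc with subst (OnArc N r c) (toℕ-π-A y≡A) onArc
    ... | inj₁ (_ , B<c+r) = <⇒≱ B<c+r (≤-pred (c+r<N c<m))
    ... | inj₂ (B<c , _) = <-asym B<c (<-trans c<A A<B)
    ¬onArc (inj₂ (inj₂ (c+r≤y , y≢B))) onArc
      with fixed (λ y≡A → <⇒≱ (subst (_< c + r) (sym y≡A) A<c+r) c+r≤y) y≢B onArc
    ... | inj₁ (_ , y<c+r) = <⇒≱ y<c+r c+r≤y
    ... | inj₂ (y<c , _) = <⇒≱ y<c (≤-trans (m≤m+n c r) c+r≤y)

  n+m≤B : n + m ≤ B
  n+m≤B = ≤-pred (subst (n + m <_) (sym N≡n+n) (+-monoʳ-< n m<n))

  ∉μarc-back : ∀ {s y} → n ≤ s → s < n + m →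
    (s ≤ toℕ y + m × toℕ y < s × toℕ y ≢ A) ⊎ toℕ y ≡ B → σ y ∉ μarc s
  ∉μarc-back {s} {y} n≤s s<n+m y-cases σy∈ =
    ¬onArc y-cases (∈μarc⇒OnArc (<-≤-trans s<n+m (≤-trans n+m≤B (<⇒≤ B<N))) σy∈)
    where
    ¬onArc : (s ≤ toℕ y + m × toℕ y < s × toℕ y ≢ A) ⊎ toℕ y ≡ B → ¬ OnArc N r s (toℕ (π y))
    ¬onArc (inj₁ (s≤y+m , y<s , y≢A)) onArc
      with subst (OnArc N r s ∘ toℕ) (π-fixes y≢A (<⇒≢ (<-≤-trans y<s (≤-trans (<⇒≤ s<n+m) n+m≤B)))) onArc
    ... | inj₁ (s≤y , _) = <⇒≱ y<s s≤y
    ... | inj₂ (_ , y+N<s+r) = <⇒≱ y+N<s+r (subst (s + r ≤_) (+m+r≡+N (toℕ y)) (+-monoˡ-≤ r s≤y+m))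
    ¬onArc (inj₂ y≡B) onArc with subst (OnArc N r s) (toℕ-π-B y≡B) onArc
    ... | inj₁ (s≤A , _) = <⇒≱ (<-≤-trans (n<1+n n') n≤s) s≤A
    ... | inj₂ (_ , A+N<s+r) = <⇒≱ A+N<s+r (subst (s + r ≤_) (+m+r≡+N A) (+-monoˡ-≤ r (≤-pred s<n+m)))

  -- The μ-interval at c misses [0, c) and window r misses [r, 2n); unless c + (k - 2) m < r,
  -- k - 2 windows cover the gap [c, r).
  present⇒+k₂m<r : ∀ {c} → 1 ≤ c → c < m → Present c → c + k₂ * m < r
  present⇒+k₂m<r {c} 1≤c c<m present = ≰⇒> λ r≤ → ¬cover Gs |Gs|≡k Gs∈F (cover r≤)
    where
    Gs = μarc c ∷ window r ∷ windows c k₂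
    |Gs|≡k : length Gs ≡ suc (suc k₂)
    |Gs|≡k = cong (suc ∘ suc) (length-windows c k₂)
    Gs∈F : All Member Gs
    Gs∈F = present ∷ window∈F 0<r ≤-refl ∷ windows∈F 1≤c k₂
    cover : r ≤ c + k₂ * m → ∀ y → Any (σ y ∉_) Gs
    cover r≤ y with r ≤? toℕ y | toℕ y <? c
    ... | yes r≤y | _ = there (here (∉window ≤-refl r≤y (subst (toℕ y <_) (sym r+m≡N) (toℕ<n y))))
    ... | no _ | yes y<c = here (∉μarc-front c<m (inj₁ y<c))
    ... | no r≰y | no y≮c = there (there (windows-miss (≮⇒≥ y≮c) (<-≤-trans (≰⇒> r≰y) r≤)))

  -- Together the μ-intervals at c and s miss [0, c), [s - m, s) and [c + r, 2n);
  -- windows cover the gaps [c, s - m) and [s, c + r).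
  ¬present-pair : ∀ {c s q₁ q₂} → 1 ≤ c → c < m → Present c → n ≤ s → s < n + m → Present s →
    q₁ + q₂ ≡ k₂ → s ≤ c + q₁ * m + m → c + r ≤ s + q₂ * m → ⊥
  ¬present-pair {c} {s} {q₁} {q₂} 1≤c c<m present-c n≤s s<n+m present-s q₁+q₂≡k₂ s≤ ≤s+ =
    ¬cover Gs |Gs|≡k Gs∈F cover
    where
    Gs = μarc c ∷ μarc s ∷ windows c q₁ ++ windows s q₂
    |Gs|≡k : length Gs ≡ suc (suc k₂)
    |Gs|≡k = cong (suc ∘ suc) (trans (length-++ (windows c q₁))
      (trans (cong₂ _+_ (length-windows c q₁) (length-windows s q₂)) q₁+q₂≡k₂))
    Gs∈F : All Member Gs
    Gs∈F = present-c ∷ present-s ∷ All.++⁺ (windows∈F 1≤c q₁) (windows∈F (≤-trans (s≤s z≤n) n≤s) q₂)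
    cover : ∀ y → Any (σ y ∉_) Gs
    cover y with toℕ y ≟ A | toℕ y ≟ B
    ... | yes y≡A | _ = here (∉μarc-front c<m (inj₂ (inj₁ y≡A)))
    ... | no _ | yes y≡B = there (here (∉μarc-back n≤s s<n+m (inj₂ y≡B)))
    ... | no y≢A | no y≢B with toℕ y <? c | c + r ≤? toℕ y | toℕ y + m <? s | toℕ y <? s
    ...   | yes y<c | _ | _ | _ = here (∉μarc-front c<m (inj₁ y<c))
    ...   | no _ | yes c+r≤y | _ | _ = here (∉μarc-front c<m (inj₂ (inj₂ (c+r≤y , y≢B))))
    ...   | no y≮c | no _ | yes y+m<s | _ =
      there (there (++⁺ˡ (windows-miss {q = q₁} (≮⇒≥ y≮c) (+-cancelʳ-< m _ _ (<-≤-trans y+m<s s≤)))))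
    ...   | no _ | no _ | no y+m≮s | yes y<s =
      there (here (∉μarc-back n≤s s<n+m (inj₁ (≮⇒≥ y+m≮s , y<s , y≢A))))
    ...   | no _ | no c+r≰y | no _ | no y≮s =
      there (there (++⁺ʳ (windows c q₁) (windows-miss {q = q₂} (≮⇒≥ y≮s) (<-≤-trans (≰⇒> c+r≰y) ≤s+))))

  ρ gap : ℕ
  ρ = r ∸ k₂ * m
  gap = m ∸ ρ

  ρ<m : ρ < m
  ρ<m = m<n+o⇒m∸n<o r (k₂ * m) (subst (r <_) (+-comm m (k₂ * m)) r<[k-1]m)

  ρ+gap≡m : ρ + gap ≡ m
  ρ+gap≡m = m+[n∸m]≡n (<⇒≤ ρ<m)

  present⇒<ρ : ∀ {v} → 1 ≤ v → v < m → Present v → v < ρ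
  present⇒<ρ {v} 1≤v v<m present-v = +-cancelʳ-< (k₂ * m) v ρ
    (subst (v + k₂ * m <_) (sym (m∸n+n≡m (≤-trans (m≤n+m (k₂ * m) v) (<⇒≤ v+k₂m<r)))) v+k₂m<r)
    where v+k₂m<r = present⇒+k₂m<r 1≤v v<m present-v

  FrontPresent : ℕ → Set
  FrontPresent v = 1 ≤ v × v < m × Present v

  module Counting {c₀} (1≤c₀ : 1 ≤ c₀) (c₀<m : c₀ < m) (present-c₀ : Present c₀)
                  (c*-absent : ¬ FrontPresent (c₀ + gap)) where

    ρ+k₂m≡r : ρ + k₂ * m ≡ r
    ρ+k₂m≡r = m∸n+n≡m (≤-trans (m≤n+m (k₂ * m) c₀) (<⇒≤ (present⇒+k₂m<r 1≤c₀ c₀<m present-c₀)))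

    c* : ℕ
    c* = c₀ + gap

    c*<m : c* < m
    c*<m = subst (c* <_) ρ+gap≡m (+-monoˡ-< gap (present⇒<ρ 1≤c₀ c₀<m present-c₀))

    ¬present-c* : ¬ Present c*
    ¬present-c* present = c*-absent (≤-trans 1≤c₀ (m≤m+n c₀ gap) , c*<m , present)

    residue : ℕ → ℕ
    residue w = (w ∸ ρ) % m

    ρ≤back : ∀ {w} → n ≤ w → ρ ≤ w
    ρ≤back n≤w = ≤-trans (<⇒≤ ρ<m) (≤-trans (<⇒≤ m<n) n≤w)

    -- ¬present-pair applied to c' and w = v + q m + ρ
    clash : ∀ {c' v w} → FrontPresent c' → c' ≤ v → v ≤ c' + gap →
      n ≤ w → w < n + m → Present w → residue w ≡ v → ⊥
    clash {c'} {v} {w} (1≤c' , c'<m , present-c') c'≤v v≤c'+gap n≤w w<n+m present-w residue≡v =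
      ¬present-pair {q₁ = q} {q₂ = k₂ ∸ q} 1≤c' c'<m present-c' n≤w w<n+m present-w (m+[n∸m]≡n q≤k₂) w≤ c'+r≤
      where
      q = (w ∸ ρ) / m
      w≡ : w ≡ v + q * m + ρ
      w≡ = trans (sym (m∸n+n≡m (ρ≤back n≤w)))
        (cong (_+ ρ) (trans (m≡m%n+[m/n]*n (w ∸ ρ) m) (cong (_+ q * m) residue≡v)))
      q≤k₂ : q ≤ k₂
      q≤k₂ = ≤-pred (*-cancelʳ-< m q (suc k₂) (+-cancelʳ-< ρ (q * m) (suc k₂ * m) (begin-strict
        q * m + ρ           ≤⟨ +-monoˡ-≤ ρ (m≤n+m (q * m) v) ⟩
        v + q * m + ρ       ≡⟨ w≡ ⟨
        w                   <⟨ w<n+m ⟩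
        n + m               <⟨ +-monoˡ-< m n<r ⟩
        r + m               ≡⟨ cong (_+ m) ρ+k₂m≡r ⟨
        ρ + k₂ * m + m      ≡⟨ shuffle ρ (k₂ * m) m ⟩
        suc k₂ * m + ρ      ∎)))
        where
        open ≤-Reasoning
        shuffle : ∀ x y z → x + y + z ≡ z + y + x
        shuffle = solve-∀
      w≤ : w ≤ c' + q * m + m
      w≤ = begin
        w                   ≡⟨ w≡ ⟩
        v + q * m + ρ       ≤⟨ +-monoˡ-≤ ρ (+-monoˡ-≤ (q * m) v≤c'+gap) ⟩
        c' + gap + q * m + ρ ≡⟨ shuffle c' gap (q * m) ρ ⟩
        c' + q * m + (ρ + gap) ≡⟨ cong (c' + q * m +_) ρ+gap≡m ⟩
        c' + q * m + m      ∎
        where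
        open ≤-Reasoning
        shuffle : ∀ x y z t → x + y + z + t ≡ x + z + (t + y)
        shuffle = solve-∀
      c'+r≤ : c' + r ≤ w + (k₂ ∸ q) * m
      c'+r≤ = begin
        c' + r              ≤⟨ +-monoˡ-≤ r c'≤v ⟩
        v + r               ≡⟨ cong (v +_) ρ+k₂m≡r ⟨
        v + (ρ + k₂ * m)    ≡⟨ cong (λ x → v + (ρ + x * m)) (m+[n∸m]≡n q≤k₂) ⟨
        v + (ρ + (q + (k₂ ∸ q)) * m) ≡⟨ shuffle v q ρ (k₂ ∸ q) m ⟩
        v + q * m + ρ + (k₂ ∸ q) * m ≡⟨ cong (_+ (k₂ ∸ q) * m) w≡ ⟨
        w + (k₂ ∸ q) * m    ∎
        where
        open ≤-Reasoning
        shuffle : ∀ x y z t u → x + (z + (y + t) * u) ≡ x + y * u + z + t * u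
        shuffle = solve-∀

    redirect : ℕ → ℕ
    redirect zero = c*
    redirect (suc i) = suc i

    -- Residue 0 is redirected to c*, which is absent.
    slot : ℕ → ℕ
    slot w = redirect (residue w)

    slot-cases : ∀ w → (residue w ≡ 0 × slot w ≡ c*) ⊎ (0 < residue w × slot w ≡ residue w)
    slot-cases w with residue w
    ... | zero = inj₁ (refl , refl)
    ... | suc i = inj₂ (s≤s z≤n , refl)

    slot<m : ∀ w → slot w < m
    slot<m w with slot-cases w
    ... | inj₁ (_ , slot≡c*) = subst (_< m) (sym slot≡c*) c*<m
    ... | inj₂ (_ , slot≡residue) = subst (_< m) (sym slot≡residue) (m%n<n (w ∸ ρ) m)

    Back : ℕ → Set
    Back w = n ≤ w × w < n + m

    residue-injective : ∀ {w w'} → Back w → Back w' → residue w ≡ residue w' → w ≡ w'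
    residue-injective {w} {w'} (n≤w , w<n+m) (n≤w' , w'<n+m) =
      ∸-cancelʳ-≡ (ρ≤back n≤w) (ρ≤back n≤w') ∘ %-injective-close (close n≤w' w<n+m n≤w) (close n≤w w'<n+m n≤w')
      where
      close : ∀ {x y} → n ≤ y → x < n + m → n ≤ x → x ∸ ρ < y ∸ ρ + m
      close {x} {y} n≤y x<n+m n≤x = subst (x ∸ ρ <_) (+-∸-comm m (ρ≤back n≤y))
        (∸-monoˡ-< (<-≤-trans x<n+m (+-monoˡ-≤ m n≤y)) (ρ≤back n≤x))

    slot≢front : ∀ {v w} → v < m → Present v → Back w → Present w → slot w ≢ v
    slot≢front {v} {w} v<m present-v (n≤w , w<n+m) present-w slot≡v with slot-cases w
    ... | inj₁ (_ , slot≡c*) = ¬present-c* (subst Present (trans (sym slot≡v) slot≡c*) present-v)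
    ... | inj₂ (0<residue , slot≡residue) =
      clash (subst (0 <_) residue≡v 0<residue , v<m , present-v) ≤-refl (m≤m+n v gap) n≤w w<n+m present-w residue≡v
      where residue≡v = trans (sym slot≡residue) slot≡v

    slot-injective : ∀ {w w'} → Back w → Present w → Back w' → Present w' → slot w ≡ slot w' → w ≡ w'
    slot-injective {w} {w'} back-w present-w back-w' present-w' slot≡ with slot-cases w | slot-cases w'
    ... | inj₁ (residue≡0 , _) | inj₁ (residue'≡0 , _) =
      residue-injective back-w back-w' (trans residue≡0 (sym residue'≡0))
    ... | inj₂ (_ , slot≡residue) | inj₂ (_ , slot'≡residue') =
      residue-injective back-w back-w' (trans (sym slot≡residue) (trans slot≡ slot'≡residue'))
    ... | inj₁ (_ , slot≡c*) | inj₂ (_ , slot'≡residue') =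
      ⊥-elim (clash (1≤c₀ , c₀<m , present-c₀) (m≤m+n c₀ gap) ≤-refl (proj₁ back-w') (proj₂ back-w') present-w'
        (trans (sym slot'≡residue') (trans (sym slot≡) slot≡c*)))
    ... | inj₂ (_ , slot≡residue) | inj₁ (_ , slot'≡c*) =
      ⊥-elim (clash (1≤c₀ , c₀<m , present-c₀) (m≤m+n c₀ gap) ≤-refl (proj₁ back-w) (proj₂ back-w) present-w
        (trans (sym slot≡residue) (trans slot≡ slot'≡c*)))

    -- Positions below n keep their number, the back block [n, n + m) goes to the slots in [1, m)
    -- and later positions move down by m; on the present positions and the absent position m
    -- this is injective with values below r.
    code : ℕ → ℕ
    code v with v <? n | v <? n + m
    ... | yes _ | _ = v
    ... | no _ | yes _ = slot v
    ... | no _ | no _ = v ∸ m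

    code-cases : ∀ v → (v < n × code v ≡ v) ⊎ (Back v × code v ≡ slot v) ⊎ (n + m ≤ v × code v ≡ v ∸ m)
    code-cases v with v <? n | v <? n + m
    ... | yes v<n | _ = inj₁ (v<n , refl)
    ... | no v≮n | yes v<n+m = inj₂ (inj₁ ((≮⇒≥ v≮n , v<n+m) , refl))
    ... | no _ | no v≮n+m = inj₂ (inj₂ (≮⇒≥ v≮n+m , refl))

    code<r : ∀ {v} → v < N → code v < r
    code<r {v} v<N with code-cases v
    ... | inj₁ (v<n , code≡v) = subst (_< r) (sym code≡v) (<-trans v<n n<r)
    ... | inj₂ (inj₁ (_ , code≡slot)) = subst (_< r) (sym code≡slot) (<-trans (slot<m v) (<-trans m<n n<r))
    ... | inj₂ (inj₂ (n+m≤v , code≡v∸m)) = subst (_< r) (sym code≡v∸m) (+-cancelˡ-< m (v ∸ m) r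
          (subst₂ _<_ (sym (m+[n∸m]≡n (≤-trans (m≤n+m m n) n+m≤v))) (sym m+r≡N) v<N))

    Eligible : ℕ → Set
    Eligible v = Present v ⊎ v ≡ m

    private
      present-back : ∀ {w} → Back w → Eligible w → Present w
      present-back _ (inj₁ present-w) = present-w
      present-back (n≤w , _) (inj₂ refl) = ⊥-elim (<⇒≱ m<n n≤w)

      slot≢eligible : ∀ {v w} → v < n → Eligible v → Back w → Eligible w → slot w ≢ v
      slot≢eligible {v} {w} v<n eligible-v back-w eligible-w with v <? m | eligible-v
      ... | yes v<m | inj₁ present-v = slot≢front v<m present-v back-w (present-back back-w eligible-w)
      ... | yes v<m | inj₂ refl = λ _ → <-irrefl refl v<m
      ... | no v≮m | _ = λ slot≡v → v≮m (subst (_< m) slot≡v (slot<m w))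

      n≤tail-code : ∀ {v} → n + m ≤ v → n ≤ v ∸ m
      n≤tail-code {v} n+m≤v = subst (_≤ v ∸ m) (m+n∸n≡m n m) (∸-monoˡ-≤ m n+m≤v)

    code-injective : ∀ {v w} → Eligible v → Eligible w → code v ≡ code w → v ≡ w
    code-injective {v} {w} eligible-v eligible-w code≡ with code-cases v | code-cases w
    ... | inj₁ (_ , cv) | inj₁ (_ , cw) = trans (sym cv) (trans code≡ cw)
    ... | inj₁ (v<n , cv) | inj₂ (inj₁ (back-w , cw)) =
      ⊥-elim (slot≢eligible v<n eligible-v back-w eligible-w (trans (sym cw) (trans (sym code≡) cv)))
    ... | inj₂ (inj₁ (back-v , cv)) | inj₁ (w<n , cw) =
      ⊥-elim (slot≢eligible w<n eligible-w back-v eligible-v (trans (sym cv) (trans code≡ cw)))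
    ... | inj₂ (inj₁ (back-v , cv)) | inj₂ (inj₁ (back-w , cw)) =
      slot-injective back-v (present-back back-v eligible-v) back-w (present-back back-w eligible-w)
        (trans (sym cv) (trans code≡ cw))
    ... | inj₂ (inj₂ (n+m≤v , cv)) | inj₂ (inj₂ (n+m≤w , cw)) =
      ∸-cancelʳ-≡ (≤-trans (m≤n+m m n) n+m≤v) (≤-trans (m≤n+m m n) n+m≤w) (trans (sym cv) (trans code≡ cw))
    ... | inj₁ (v<n , cv) | inj₂ (inj₂ (n+m≤w , cw)) =
      ⊥-elim (<⇒≱ v<n (subst (n ≤_) (trans (sym cw) (trans (sym code≡) cv)) (n≤tail-code n+m≤w)))
    ... | inj₂ (inj₂ (n+m≤v , cv)) | inj₁ (w<n , cw) =
      ⊥-elim (<⇒≱ w<n (subst (n ≤_) (trans (sym cv) (trans code≡ cw)) (n≤tail-code n+m≤v)))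
    ... | inj₂ (inj₁ (_ , cv)) | inj₂ (inj₂ (n+m≤w , cw)) =
      ⊥-elim (<⇒≱ (<-trans (slot<m v) m<n)
        (subst (n ≤_) (trans (sym cw) (trans (sym code≡) cv)) (n≤tail-code n+m≤w)))
    ... | inj₂ (inj₂ (n+m≤v , cv)) | inj₂ (inj₁ (_ , cw)) =
      ⊥-elim (<⇒≱ (<-trans (slot<m w) m<n)
        (subst (n ≤_) (trans (sym cv) (trans code≡ cw)) (n≤tail-code n+m≤v)))

    count<r : countFσ n F μ r < r
    count<r = length-filter< (λ p → F (interval n μ r p)) (code ∘ toℕ) (m mod N) (¬-not ¬present-m)
      (λ i _ → code<r (toℕ<n i))
      (λ _ _ eligible-i eligible-j → toℕ-injective ∘ code-injective (eligible eligible-i) (eligible eligible-j))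
      where
      eligible : ∀ {i} → F (interval n μ r i) ≡ true ⊎ i ≡ m mod N → Eligible (toℕ i)
      eligible {i} (inj₁ Fi) = inj₁ (subst (λ p → F (interval n μ r p) ≡ true) (sym (mod-toℕ i)) Fi)
      eligible (inj₂ refl) = inj₂ (toℕ-mod m<N)

  ¬present-front : ∀ {c} → 1 ≤ c → c < m → ¬ Present c
  ¬present-front 1≤c c<m present
    with bounded⇒exit FrontPresent (λ v → 1 ≤? v ×-dec v <? m ×-dec F (μarc v) Bool.≟ true) (m<n⇒0<n∸m ρ<m)
           (λ (1≤v , v<m , present-v) → present⇒<ρ 1≤v v<m present-v) (1≤c , c<m , present)
  ... | c₀ , (1≤c₀ , c₀<m , present-c₀) , c*-absent =
    <-irrefl μ-saturated (Counting.count<r 1≤c₀ c₀<m present-c₀ c*-absent)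

  present⇒OnArc-0 : ∀ {v} → Present v → OnArc N r v 0
  present⇒OnArc-0 {zero} _ = inj₁ (z≤n , 0<r)
  present⇒OnArc-0 {v@(suc _)} present with m <? v
  ... | yes m<v = inj₂ (s≤s z≤n , subst (_< v + r) m+r≡N (+-monoˡ-< r m<v))
  ... | no m≮v with v ≟ m
  ...   | yes v≡m = ⊥-elim (¬present-m (subst Present v≡m present))
  ...   | no v≢m = ⊥-elim (¬present-front (s≤s z≤n) (≤∧≢⇒< (≮⇒≥ m≮v) v≢m) present)

  μ-allContain : AllContainLast n F μ r
  μ-allContain p z present z≡0 = OnArc⇒∈-interval μ (<⇒≤ r<N)
    (subst (OnArc N r (toℕ p)) (sym z≡0)
      (present⇒OnArc-0 (subst (λ q → F (interval n μ r q) ≡ true) (sym (mod-toℕ p)) present)))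

lemma3p2 : (n k r : ℕ) → 2 ≤ k → n < r → r * k < (k ∸ 1) * (2 * n) →
    (F : Family n) → SubfamilyH n r F → KWiseIntersecting n k F →
    (σ : Ordering n) → GoodCyclic n σ → Saturated n F σ r → AllContainLast n F σ r →
    (μ : Ordering n) → SwapOf n σ μ → GoodCyclic n μ →
    Saturated n F μ r → AllContainLast n F μ r
lemma3p2 zero k r _ _ rk<0 = ⊥-elim (n≮0 (subst (r * k <_) (*-zeroʳ (k ∸ 1)) rk<0))
lemma3p2 (suc n') (suc (suc k₂)) r _ n<r rk<[k-1]N F _ kwise
         σ σ-good σ-saturated σ-allContain μ swapped μ-good μ-saturated =
  SwapArgument.μ-allContain n' k₂ r n<r rk<[k-1]N F kwise
    σ σ-good σ-saturated σ-allContain μ swapped μ-good μ-saturated
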